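{- Let $n\ge 1$ and $x\ge 0$ be integers. Then $F(x,x)$ is even.
   Context: For a fixed integer $n\ge0$, define $F:\mathbb{Z}^2\to\mathbb{Z}_{\ge0}$ by $F(0,0)=2^n$, $F(x,y)=\lfloor F(x-1,y)/2\rfloor+\lfloor F(x,y-1)/2\rfloor$ for every $(x,y)\in\mathbb{Z}_{\ge0}^2\setminus\{(0,0)\}$, and $F(x,y)=0$ for $(x,y)$ outside the first quadrant. This is the intermediate firing configuration of chip-firing on the quadrant lattice graph (vertices $\mathbb{Z}_{\ge0}^2$, edges $(x,y)\to(x+1,y)$, $(x,y)\to(x,y+1)$; a vertex with at least 2 chips fires one chip to each out-neighbour) started with $2^n$ chips at the origin and fired row by row: $F(x,y)$ is the number of chips received by $(x,y)$. -}

module Defs where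

open import Data.Nat using (ℕ; zero; suc; _+_; _^_; _/_)

-- F n x y : chips received by vertex (x , y) in the quadrant chip-firing
-- started with 2^n chips at the origin.  Vertices outside the first
-- quadrant (value 0) never arise as ℕ coordinates; they are handled by
-- the boundary cases below (a missing neighbour contributes 0).
F : ℕ → ℕ → ℕ → ℕ
F n zero    zero    = 2 ^ n
F n (suc x) zero    = F n x zero / 2
F n zero    (suc y) = F n zero y / 2
F n (suc x) (suc y) = F n x (suc y) / 2 + F n (suc x) y / 2

{-# OPTIONS --safe #-}
module Submission where

-- The chip-firing is symmetric under swapping the coordinates, so a diagonal
-- vertex (x+1, x+1) receives the same amount ⌊F(x, x+1)/2⌋ from each of its
-- two in-neighbours; the origin holds 2^n chips, which is even as n ≥ 1.

open import Defs
open import Data.Nat using (ℕ; _≥_; zero; suc; _+_; _/_; _^_)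
open import Data.Nat.Properties using (+-comm; +-identityʳ)
open import Data.Nat.Divisibility using (_∣_; m∣m*n)
open import Relation.Binary.PropositionalEquality using (_≡_; refl; cong; cong₂; subst; trans)

F-sym : ∀ n x y → F n x y ≡ F n y x
F-sym n zero    zero    = refl
F-sym n (suc x) zero    = cong (_/ 2) (F-sym n x zero)
F-sym n zero    (suc y) = cong (_/ 2) (F-sym n zero y)
F-sym n (suc x) (suc y) =
  trans (cong₂ (λ a b → a / 2 + b / 2) (F-sym n x (suc y)) (F-sym n (suc x) y))
        (+-comm (F n (suc y) x / 2) (F n y (suc x) / 2))

F-diagonal-suc : ∀ n x → F n (suc x) (suc x) ≡ F n x (suc x) / 2 + F n x (suc x) / 2
F-diagonal-suc n x = cong (λ b → F n x (suc x) / 2 + b / 2) (F-sym n (suc x) x)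

2∣m+m : ∀ m → 2 ∣ m + m
2∣m+m m = subst (λ k → 2 ∣ m + k) (+-identityʳ m) (m∣m*n m)

proposition4p5 : (n : ℕ) → n ≥ 1 → (x : ℕ) → 2 ∣ F n x x
proposition4p5 (suc n) _ zero    = m∣m*n (2 ^ n)
proposition4p5 n       _ (suc x) rewrite F-diagonal-suc n x = 2∣m+m (F n x (suc x) / 2)
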